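{- Let $\mathcal{M}=(X,\leq,R,V)$ be a strictly condensed $\mathsf{Bi\text{ - }int}_{\Box}$-model and $\phi\in\mathsf{Bi\text{ - }int}_\Box$. Then for all $x\in X$: $\mathcal{M},x\Vdash\phi$ if and only if $\mathcal{M}^\partial,x\not\Vdash\phi^t$, where $\phi^t\in\mathsf{Bi\text{ - }int}_\Diamond$ is evaluated in the $\mathsf{Bi\text{ - }int}_\Diamond$-model $\mathcal{M}^\partial$.
   Context: $\mathsf{Bi\text{ - }int}_\Box$ (resp. $\mathsf{Bi\text{ - }int}_\Diamond$): $\phi::=\top\mid\bot\mid p\mid\phi\wedge\phi\mid\phi\vee\phi\mid\phi\to\phi\mid\phi\,{ -\!\!<}\,\phi\mid\Box\phi$ (resp. $\Diamond\phi$). Write $x(Z\circ Z')y$ iff $\exists u$, $xZu$, $uZ'y$. A $\mathsf{Bi\text{ - }int}_\Box$-model is $(X,\leq,R,V)$ with $\leq$ a preorder, $({\leq}\circ R)\subseteq(R\circ{\leq})$, $V(p)$ upsets of $(X,\leq)$; strictly condensed if $({\leq}\circ R\circ{\leq})\subseteq R$. A $\mathsf{Bi\text{ - }int}_\Diamond$-model is $(X,\leq,S,V)$ with $({\geq}\circ S)\subseteq(S\circ{\geq})$. Truth: $x\Vdash p$ iff $x\in V(p)$; $\top,\bot,\wedge,\vee$ as usual; $x\Vdash\phi\to\psi$ iff all $y\geq x$ with $y\Vdash\phi$ satisfy $\psi$; $x\Vdash\phi\,{ -\!\!<}\,\psi$ iff some $y\leq x$ has $y\Vdash\phi$, $y\not\Vdash\psi$;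 $x\Vdash\Box\phi$ iff all $y$ with $xRy$ satisfy $\phi$; $x\Vdash\Diamond\phi$ iff some $y$ with $xSy$ satisfies $\phi$. The dual of $(X,\leq,R,V)$ is $\mathcal{M}^\partial=(X,\geq,R,V^\partial)$ with $V^\partial(p)=X\setminus V(p)$, viewed as a $\mathsf{Bi\text{ - }int}_\Diamond$-model with order $\geq$ and diamond relation $R$. The translation $(\cdot)^t$: $\bot^t=\top$, $\top^t=\bot$, $p^t=p$, $(\phi\wedge\psi)^t=\phi^t\vee\psi^t$, $(\phi\vee\psi)^t=\phi^t\wedge\psi^t$, $(\phi\to\psi)^t=\psi^t\,{ -\!\!<}\,\phi^t$, $(\phi\,{ -\!\!<}\,\psi)^t=\psi^t\to\phi^t$, $(\Box\phi)^t=\Diamond\phi^t$. -}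

module Defs where

open import Level using (Level; _⊔_; suc)
open import Data.Product using (∃; _×_; _,_)
open import Data.Sum using (_⊎_)
open import Relation.Nullary using (¬_)
open import Relation.Binary using (Rel; IsPreorder)
open import Relation.Binary.PropositionalEquality using (_≡_)

data FmBox (Var : Set) : Set where
  ⊤ᵇ ⊥ᵇ : FmBox Var
  varᵇ  : Var → FmBox Var
  _∧ᵇ_ _∨ᵇ_ _⇒ᵇ_ _−<ᵇ_ : FmBox Var → FmBox Var → FmBox Var
  □ᵇ    : FmBox Var → FmBox Var

data FmDia (Var : Set) : Set where
  ⊤ᵈ ⊥ᵈ : FmDia Var
  varᵈ  : Var → FmDia Var
  _∧ᵈ_ _∨ᵈ_ _⇒ᵈ_ _−<ᵈ_ : FmDia Var → FmDia Var → FmDia Var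
  ◇ᵈ    : FmDia Var → FmDia Var

_∘ʳ_ : ∀ {a ℓ₁ ℓ₂} {X : Set a} → Rel X ℓ₁ → Rel X ℓ₂ → Rel X (a ⊔ ℓ₁ ⊔ ℓ₂)
(Z ∘ʳ Z′) x y = ∃ λ u → Z x u × Z′ u y

_⊆ʳ_ : ∀ {a ℓ₁ ℓ₂} {X : Set a} → Rel X ℓ₁ → Rel X ℓ₂ → Set (a ⊔ ℓ₁ ⊔ ℓ₂)
Z ⊆ʳ Z′ = ∀ {x y} → Z x y → Z′ x y

conv : ∀ {a ℓ} {X : Set a} → Rel X ℓ → Rel X ℓ
conv Z x y = Z y x

IsUpset : ∀ {a ℓ ℓ′} {X : Set a} → Rel X ℓ → (X → Set ℓ′) → Set (a ⊔ ℓ ⊔ ℓ′)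
IsUpset _≤_ U = ∀ {x y} → x ≤ y → U x → U y

record BoxModel (Var : Set) (a ℓ : Level) : Set (suc (a ⊔ ℓ)) where
  field
    X     : Set a
    _≤_   : Rel X ℓ
    R     : Rel X ℓ
    V     : Var → X → Set ℓ
    ≤-pre : IsPreorder _≡_ _≤_
    frame : (_≤_ ∘ʳ R) ⊆ʳ (R ∘ʳ _≤_)
    V-up  : ∀ p → IsUpset _≤_ (V p)

record DiaModel (Var : Set) (a ℓ : Level) : Set (suc (a ⊔ ℓ)) where
  field
    X     : Set a
    _≤_   : Rel X ℓ
    S     : Rel X ℓ
    V     : Var → X → Set ℓ
    ≤-pre : IsPreorder _≡_ _≤_
    frame : (conv _≤_ ∘ʳ S) ⊆ʳ (S ∘ʳ conv _≤_)
    V-up  : ∀ p → IsUpset _≤_ (V p)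

StrictlyCondensed : ∀ {Var a ℓ} → BoxModel Var a ℓ → Set (a ⊔ ℓ)
StrictlyCondensed M = ((_≤_ ∘ʳ R) ∘ʳ _≤_) ⊆ʳ R
  where open BoxModel M

module _ {Var : Set} {a ℓ : Level} (M : BoxModel Var a ℓ) where
  open BoxModel M
  infix 4 _⊩ᵇ_
  _⊩ᵇ_ : X → FmBox Var → Set (a ⊔ ℓ)
  x ⊩ᵇ ⊤ᵇ = Level.Lift _ Data.Unit.⊤ where import Data.Unit
  x ⊩ᵇ ⊥ᵇ = Level.Lift _ Data.Empty.⊥ where import Data.Empty
  x ⊩ᵇ varᵇ p = Level.Lift a (V p x)
  x ⊩ᵇ (φ ∧ᵇ ψ) = x ⊩ᵇ φ × x ⊩ᵇ ψ
  x ⊩ᵇ (φ ∨ᵇ ψ) = x ⊩ᵇ φ ⊎ x ⊩ᵇ ψ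
  x ⊩ᵇ (φ ⇒ᵇ ψ) = ∀ y → x ≤ y → y ⊩ᵇ φ → y ⊩ᵇ ψ
  x ⊩ᵇ (φ −<ᵇ ψ) = ∃ λ y → y ≤ x × y ⊩ᵇ φ × ¬ (y ⊩ᵇ ψ)
  x ⊩ᵇ □ᵇ φ = ∀ y → R x y → y ⊩ᵇ φ

module _ {Var : Set} {a ℓ : Level} (M : DiaModel Var a ℓ) where
  open DiaModel M
  infix 4 _⊩ᵈ_
  _⊩ᵈ_ : X → FmDia Var → Set (a ⊔ ℓ)
  x ⊩ᵈ ⊤ᵈ = Level.Lift _ Data.Unit.⊤ where import Data.Unit
  x ⊩ᵈ ⊥ᵈ = Level.Lift _ Data.Empty.⊥ where import Data.Empty
  x ⊩ᵈ varᵈ p = Level.Lift a (V p x)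
  x ⊩ᵈ (φ ∧ᵈ ψ) = x ⊩ᵈ φ × x ⊩ᵈ ψ
  x ⊩ᵈ (φ ∨ᵈ ψ) = x ⊩ᵈ φ ⊎ x ⊩ᵈ ψ
  x ⊩ᵈ (φ ⇒ᵈ ψ) = ∀ y → x ≤ y → y ⊩ᵈ φ → y ⊩ᵈ ψ
  x ⊩ᵈ (φ −<ᵈ ψ) = ∃ λ y → y ≤ x × y ⊩ᵈ φ × ¬ (y ⊩ᵈ ψ)
  x ⊩ᵈ ◇ᵈ φ = ∃ λ y → S x y × y ⊩ᵈ φ

_ᵗ : ∀ {Var} → FmBox Var → FmDia Var
⊤ᵇ ᵗ = ⊥ᵈ
⊥ᵇ ᵗ = ⊤ᵈ
varᵇ p ᵗ = varᵈ p
(φ ∧ᵇ ψ) ᵗ = (φ ᵗ) ∨ᵈ (ψ ᵗ)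
(φ ∨ᵇ ψ) ᵗ = (φ ᵗ) ∧ᵈ (ψ ᵗ)
(φ ⇒ᵇ ψ) ᵗ = (ψ ᵗ) −<ᵈ (φ ᵗ)
(φ −<ᵇ ψ) ᵗ = (ψ ᵗ) ⇒ᵈ (φ ᵗ)
□ᵇ φ ᵗ = ◇ᵈ (φ ᵗ)

-- Excluded middle (classical metatheory of the paper), at a given level
ExcludedMiddle : (ℓ : Level) → Set (suc ℓ)
ExcludedMiddle ℓ = (P : Set ℓ) → P ⊎ ¬ P

-- the dual model M^∂ = (X, ≥, R, V^∂), V^∂(p) = X ∖ V(p), as a Bi-int_◇-model
dual : ∀ {Var a ℓ} → BoxModel Var a ℓ → DiaModel Var a ℓ
dual {Var} {a} {ℓ} M = record
  { X     = X
  ; _≤_   = conv _≤_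
  ; S     = R
  ; V     = λ p x → ¬ V p x
  ; ≤-pre = record
      { isEquivalence = IsPreorder.isEquivalence ≤-pre
      ; reflexive     = λ { Relation.Binary.PropositionalEquality.refl → IsPreorder.refl ≤-pre }
      ; trans         = λ p q → IsPreorder.trans ≤-pre q p
      }
  ; frame = frame
  ; V-up  = λ p y≤x ¬Vx Vy → ¬Vx (V-up p y≤x Vy)
  }
  where open BoxModel M

{-# OPTIONS --safe #-}
module Submission where

open import Defs
open import Level using (Level; _⊔_; lift; lower)
open import Function.Bundles using (_⇔_; mk⇔)
open import Relation.Nullary using (¬_)
open import Data.Product using (_,_)
open import Data.Sum using (inj₁; inj₂)
open import Data.Empty using (⊥-elim)

-- Induction on φ: (·)ᵗ sends each connective to its De Morgan dual, and reversing
-- the order swaps ⇒ with −< while V^∂ complements V. Excluded middle is needed only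
-- to turn a refuted dual formula into a positive one (variables, ∨ and −<).

module _ {Var : Set} {a ℓ : Level} (em : ExcludedMiddle (a ⊔ ℓ)) (M : BoxModel Var a ℓ) where
  open BoxModel M

  private
    infix 4 _⊩_ _⊩∂_

    _⊩_ : X → FmBox Var → Set (a ⊔ ℓ)
    _⊩_ = _⊩ᵇ_ M

    _⊩∂_ : X → FmDia Var → Set (a ⊔ ℓ)
    _⊩∂_ = _⊩ᵈ_ (dual M)

  ¬¬-elim : {P : Set (a ⊔ ℓ)} → ¬ ¬ P → P
  ¬¬-elim {P} ¬¬p with em P
  ... | inj₁ p  = p
  ... | inj₂ ¬p = ⊥-elim (¬¬p ¬p)

  mutual
    ⊩⇒¬⊩∂ᵗ : ∀ φ {x} → x ⊩ φ → ¬ x ⊩∂ φ ᵗ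
    ⊩⇒¬⊩∂ᵗ ⊤ᵇ       _         ()
    ⊩⇒¬⊩∂ᵗ (varᵇ p) v         ¬v             = lower ¬v (lower v)
    ⊩⇒¬⊩∂ᵗ (φ ∧ᵇ ψ) (u , _)   (inj₁ d)       = ⊩⇒¬⊩∂ᵗ φ u d
    ⊩⇒¬⊩∂ᵗ (φ ∧ᵇ ψ) (_ , v)   (inj₂ d)       = ⊩⇒¬⊩∂ᵗ ψ v d
    ⊩⇒¬⊩∂ᵗ (φ ∨ᵇ ψ) (inj₁ u)  (d , _)        = ⊩⇒¬⊩∂ᵗ φ u d
    ⊩⇒¬⊩∂ᵗ (φ ∨ᵇ ψ) (inj₂ v)  (_ , e)        = ⊩⇒¬⊩∂ᵗ ψ v e
    ⊩⇒¬⊩∂ᵗ (φ ⇒ᵇ ψ) f         (y , x≤y , dψ , ¬dφ) =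
      ⊩⇒¬⊩∂ᵗ ψ (f y x≤y (¬⊩∂ᵗ⇒⊩ φ ¬dφ)) dψ
    ⊩⇒¬⊩∂ᵗ (φ −<ᵇ ψ) (y , y≤x , u , ¬v) f =
      ⊩⇒¬⊩∂ᵗ φ u (f y y≤x (¬⊩⇒⊩∂ᵗ ψ ¬v))
    ⊩⇒¬⊩∂ᵗ (□ᵇ φ)   f         (y , xRy , d)  = ⊩⇒¬⊩∂ᵗ φ (f y xRy) d

    ¬⊩∂ᵗ⇒⊩ : ∀ φ {x} → ¬ x ⊩∂ φ ᵗ → x ⊩ φ
    ¬⊩∂ᵗ⇒⊩ ⊤ᵇ        _  = lift _
    ¬⊩∂ᵗ⇒⊩ ⊥ᵇ        ¬d = ⊥-elim (¬d (lift _))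
    ¬⊩∂ᵗ⇒⊩ (varᵇ p)  ¬d = ¬¬-elim λ ¬v → ¬d (lift λ v → ¬v (lift v))
    ¬⊩∂ᵗ⇒⊩ (φ ∧ᵇ ψ)  ¬d = ¬⊩∂ᵗ⇒⊩ φ (λ d → ¬d (inj₁ d)) , ¬⊩∂ᵗ⇒⊩ ψ (λ e → ¬d (inj₂ e))
    ¬⊩∂ᵗ⇒⊩ (φ ∨ᵇ ψ) {x} ¬d with em (x ⊩ φ)
    ... | inj₁ u  = inj₁ u
    ... | inj₂ ¬u = inj₂ (¬⊩∂ᵗ⇒⊩ ψ λ e → ¬d (¬⊩⇒⊩∂ᵗ φ ¬u , e))
    ¬⊩∂ᵗ⇒⊩ (φ ⇒ᵇ ψ)  ¬d = λ y x≤y u → ¬⊩∂ᵗ⇒⊩ ψ λ dψ → ¬d (y , x≤y , dψ , ⊩⇒¬⊩∂ᵗ φ u)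
    ¬⊩∂ᵗ⇒⊩ (φ −<ᵇ ψ) ¬d = ¬¬-elim λ ¬w →
      ¬d λ y y≤x dψ → ¬⊩⇒⊩∂ᵗ φ λ u → ¬w (y , y≤x , u , λ v → ⊩⇒¬⊩∂ᵗ ψ v dψ)
    ¬⊩∂ᵗ⇒⊩ (□ᵇ φ)    ¬d = λ y xRy → ¬⊩∂ᵗ⇒⊩ φ λ d → ¬d (y , xRy , d)

    ¬⊩⇒⊩∂ᵗ : ∀ φ {x} → ¬ x ⊩ φ → x ⊩∂ φ ᵗ
    ¬⊩⇒⊩∂ᵗ φ ¬u = ¬¬-elim λ ¬d → ¬u (¬⊩∂ᵗ⇒⊩ φ ¬d)

  ⊩⇔¬⊩∂ᵗ : ∀ φ x → x ⊩ φ ⇔ (¬ x ⊩∂ φ ᵗ)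
  ⊩⇔¬⊩∂ᵗ φ x = mk⇔ (⊩⇒¬⊩∂ᵗ φ) (¬⊩∂ᵗ⇒⊩ φ)

lemma5p13 : ∀ {Var : Set} {a ℓ : Level} → ExcludedMiddle (a ⊔ ℓ) →
    (M : BoxModel Var a ℓ) → StrictlyCondensed M →
    (φ : FmBox Var) (x : BoxModel.X M) →
    (_⊩ᵇ_ M x φ) ⇔ (¬ (_⊩ᵈ_ (dual M) x (φ ᵗ)))
lemma5p13 em M _ = ⊩⇔¬⊩∂ᵗ em M
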